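{- Let $G=(V,E)$ be an undirected graph and let $H=(W,F)$ be the bipartite graph with $W=V\cup V'$, where $V'=\{v':v\in V\}$ is a disjoint copy of $V$, and $\{u,v'\}\in F$ iff $\{u,v\}\in E$ or $u=v$. If $M$ is an independent set of edges in $H$, then $S:=W(M)\cap V$ is an irredundant set in $G$. Conversely, if $S$ is an irredundant set in $G$, then there exists an independent set of edges $M\subseteq F$ such that $S=W(M)\cap V$. In both cases $|M|=|S|$.
   Context: $W(M)$ denotes the set of endpoints of edges in $M$. A set of edges $M\subseteq F$ is independent if no two edges of $M$ share an endpoint and $W(M)$ is an independent set in $(W,F\setminus M)$. A vertex $v$ dominates $u$ if $u=v$ or $uv\in E$; $S\subseteq V$ is irredundant if for each $v\in S$ there is $u\in V$ dominated by $v$ and by no vertex of $S\setminus\{v\}$. -}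

module Defs where

open import Data.Nat using (ℕ)
open import Data.Fin using (Fin)
open import Data.Fin.Subset using (Subset; _∈_; _∉_)
open import Data.Product using (_×_; _,_; ∃-syntax; proj₁; proj₂)
open import Data.Sum using (_⊎_; inj₁; inj₂)
open import Data.List using (List)
open import Data.List.Relation.Unary.All using (All)
open import Data.List.Relation.Unary.Unique.Propositional using (Unique)
import Data.List.Membership.Propositional as LM
open import Relation.Binary.PropositionalEquality using (_≡_; _≢_)
open import Relation.Nullary using (¬_)
open import Relation.Binary.Definitions using (Decidable)

record Graph (n : ℕ) : Set₁ where
  field
    Adj     : Fin n → Fin n → Set
    adj?    : Decidable Adj
    sym     : ∀ {u v} → Adj u v → Adj v u
    irrefl  : ∀ {u} → ¬ Adj u u

open Graph public

Dominates : ∀ {n} → Graph n → Fin n → Fin n → Set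
Dominates G v u = (u ≡ v) ⊎ Adj G v u

Irredundant : ∀ {n} → Graph n → Subset n → Set
Irredundant {n} G S =
  ∀ v → v ∈ S → ∃[ u ] (Dominates G v u × (∀ w → w ∈ S → w ≢ v → ¬ Dominates G w u))

-- The bipartite graph H = (V ∪ V', F).  A pair (u , v) : Fin n × Fin n
-- stands for the H-edge {u, v'} with u ∈ V and v' ∈ V'.
-- {u, v'} ∈ F  iff  uv ∈ E or u = v.
HEdge : ∀ {n} → Graph n → Fin n → Fin n → Set
HEdge G u v = (u ≡ v) ⊎ Adj G u v

-- Vertices of H: inj₁ u = u ∈ V, inj₂ v = v' ∈ V'.
HVertex : ℕ → Set
HVertex n = Fin n ⊎ Fin n

InW : ∀ {n} → List (Fin n × Fin n) → HVertex n → Set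
InW M (inj₁ u) = ∃[ v ] (LM._∈_ (u , v) M)
InW M (inj₂ v) = ∃[ u ] (LM._∈_ (u , v) M)

-- M is an independent set of edges of H: a set (duplicate-free list) of
-- edges of F, no two distinct edges sharing an endpoint, and W(M) is an
-- independent set in (W, F ∖ M).  (H is bipartite, so every edge of F
-- joins some u ∈ V to some v' ∈ V'.)
record IndependentEdges {n : ℕ} (G : Graph n) (M : List (Fin n × Fin n)) : Set where
  field
    unique    : Unique M
    subsetF   : All (λ e → HEdge G (proj₁ e) (proj₂ e)) M
    disjointV : ∀ {u v w} → LM._∈_ (u , v) M → LM._∈_ (u , w) M → v ≡ w
    disjointV' : ∀ {u w v} → LM._∈_ (u , v) M → LM._∈_ (w , v) M → u ≡ w
    indepW    : ∀ u v → HEdge G u v → ¬ (LM._∈_ (u , v) M) →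
                ¬ (InW M (inj₁ u) × InW M (inj₂ v))

IsVPart : ∀ {n} → List (Fin n × Fin n) → Subset n → Set
IsVPart {n} M S = ∀ (u : Fin n) → (u ∈ S → InW M (inj₁ u)) × (InW M (inj₁ u) → u ∈ S)

-- If (u , v′) is an edge of an independent set M of edges, then v′ is a private vertex of u
-- in S = W(M) ∩ V: any w ∈ S dominating v′ gives an edge {w , v′} of F with both ends in
-- W(M), which independence forces into M, and then w = u since M is a matching.
-- Conversely, matching every v ∈ S with a chosen private vertex of v yields such an M:
-- privacy makes the chosen vertices distinct and forbids every other edge of F between
-- S and the chosen vertices.  In both directions the edges of M are indexed by S.
module Submission where

open import Defs hiding (sym)
open import Data.Bool using (true; false)
open import Data.Empty using (⊥-elim)
open import Data.Fin using (Fin; zero; suc; _≟_)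
open import Data.Fin.Properties using (suc-injective)
open import Data.Fin.Subset using (Subset; ∣_∣)
import Data.Fin.Subset as Subset
open import Data.Fin.Subset.Properties using (_∈?_)
open import Data.List using (List; []; _∷_; length; map)
open import Data.List.Membership.Propositional using (_∈_)
open import Data.List.Membership.Propositional.Properties using (∈-map⁺; ∈-map⁻)
open import Data.List.Membership.Propositional.Properties.WithK using (unique∧set⇒bag)
open import Data.List.Properties using (length-map)
open import Data.List.Relation.Binary.BagAndSetEquality using (∼bag⇒↭)
open import Data.List.Relation.Binary.Permutation.Propositional.Properties using (↭-length)
open import Data.List.Relation.Unary.All as All using (All)
import Data.List.Relation.Unary.All.Properties as All
open import Data.List.Relation.Unary.AllPairs using ([]; _∷_)
open import Data.List.Relation.Unary.Any using (here; there)
open import Data.List.Relation.Unary.Unique.Propositional using (Unique)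
import Data.List.Relation.Unary.Unique.Propositional.Properties as Unique
open import Data.Nat using (ℕ; suc)
open import Data.Product using (_×_; _,_; ∃-syntax; proj₁; proj₂)
open import Data.Sum using (inj₁; inj₂)
open import Data.Vec as Vec using ([]; _∷_)
open import Function using (_∘_)
open import Function.Bundles using (mk⇔)
open import Relation.Binary.PropositionalEquality
  using (_≡_; _≢_; refl; sym; trans; cong; subst)
open import Relation.Nullary using (¬_; yes; no)

elements : ∀ {n} → Subset n → List (Fin n)
elements []          = []
elements (true ∷ p)  = zero ∷ map suc (elements p)
elements (false ∷ p) = map suc (elements p)

∣p∣≡length-elements : ∀ {n} (p : Subset n) → ∣ p ∣ ≡ length (elements p)
∣p∣≡length-elements []          = refl
∣p∣≡length-elements (true ∷ p)  =
  cong suc (trans (∣p∣≡length-elements p) (sym (length-map suc (elements p))))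
∣p∣≡length-elements (false ∷ p) =
  trans (∣p∣≡length-elements p) (sym (length-map suc (elements p)))

suc∈map-suc⁻ : ∀ {n} {x : Fin n} {xs} → suc x ∈ map suc xs → x ∈ xs
suc∈map-suc⁻ x∈ with ∈-map⁻ suc x∈
... | _ , y∈ , x≡y = subst (_∈ _) (sym (suc-injective x≡y)) y∈

zero∉map-suc : ∀ {n} {xs : List (Fin n)} → ¬ (zero ∈ map suc xs)
zero∉map-suc z∈ with ∈-map⁻ suc z∈
... | _ , _ , ()

∈-elements⁻ : ∀ {n} (p : Subset n) {x} → x ∈ elements p → x Subset.∈ p
∈-elements⁻ (true ∷ p)  {zero}  _          = Vec.here
∈-elements⁻ (true ∷ p)  {suc x} (there x∈) = Vec.there (∈-elements⁻ p (suc∈map-suc⁻ x∈))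
∈-elements⁻ (false ∷ p) {zero}  z∈         = ⊥-elim (zero∉map-suc z∈)
∈-elements⁻ (false ∷ p) {suc x} x∈         = Vec.there (∈-elements⁻ p (suc∈map-suc⁻ x∈))

∈-elements⁺ : ∀ {n} (p : Subset n) {x} → x Subset.∈ p → x ∈ elements p
∈-elements⁺ (true ∷ p)  Vec.here       = here refl
∈-elements⁺ (true ∷ p)  (Vec.there x∈) = there (∈-map⁺ suc (∈-elements⁺ p x∈))
∈-elements⁺ (false ∷ p) (Vec.there x∈) = ∈-map⁺ suc (∈-elements⁺ p x∈)

elements-unique : ∀ {n} (p : Subset n) → Unique (elements p)
elements-unique []          = []
elements-unique (true ∷ p)  =
  All.tabulate (λ z∈ z≡ → zero∉map-suc (subst (_∈ _) (sym z≡) z∈))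
  ∷ Unique.map⁺ suc-injective (elements-unique p)
elements-unique (false ∷ p) = Unique.map⁺ suc-injective (elements-unique p)

length-listing≡∣p∣ : ∀ {n} {xs : List (Fin n)} (p : Subset n) → Unique xs →
  (∀ {x} → x ∈ xs → x Subset.∈ p) → (∀ {x} → x Subset.∈ p → x ∈ xs) →
  length xs ≡ ∣ p ∣
length-listing≡∣p∣ p xs-unique ⊆p p⊆ =
  trans (↭-length (∼bag⇒↭ (unique∧set⇒bag xs-unique (elements-unique p)
          (mk⇔ (∈-elements⁺ p ∘ ⊆p) (p⊆ ∘ ∈-elements⁻ p)))))
        (sym (∣p∣≡length-elements p))

Unique-map⁺-on : ∀ {A B : Set} {f : A → B} {xs} →
  (∀ {x y} → x ∈ xs → y ∈ xs → f x ≡ f y → x ≡ y) →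
  Unique xs → Unique (map f xs)
Unique-map⁺-on f-inj []                 = []
Unique-map⁺-on f-inj (x∉xs ∷ xs-unique) =
  All.map⁺ (All.tabulate λ y∈ fx≡fy → All.lookup x∉xs y∈ (f-inj (here refl) (there y∈) fx≡fy))
  ∷ Unique-map⁺-on (λ x∈ y∈ → f-inj (there x∈) (there y∈)) xs-unique

Dominates⇒HEdge : ∀ {n} (G : Graph n) {u x} → Dominates G u x → HEdge G u x
Dominates⇒HEdge G (inj₁ x≡u) = inj₁ (sym x≡u)
Dominates⇒HEdge G (inj₂ ux)  = inj₂ ux

HEdge⇒Dominates : ∀ {n} (G : Graph n) {u x} → HEdge G u x → Dominates G u x
HEdge⇒Dominates G (inj₁ u≡x) = inj₁ (sym u≡x)
HEdge⇒Dominates G (inj₂ ux)  = inj₂ ux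

module FromIndependentEdges {n} (G : Graph n) {M : List (Fin n × Fin n)} {S : Subset n}
  (M-indep : IndependentEdges G M) (M-covers : IsVPart M S) where
  open IndependentEdges M-indep

  irredundant : Irredundant G S
  irredundant v v∈S with proj₁ (M-covers v) v∈S
  ... | x , vx∈M = x , HEdge⇒Dominates G (All.lookup subsetF vx∈M) , x-private
    where
    x-private : ∀ w → w Subset.∈ S → w ≢ v → ¬ Dominates G w x
    x-private w w∈S w≢v w→x with proj₁ (M-covers w) w∈S
    ... | y , wy∈M = indepW w x (Dominates⇒HEdge G w→x)
                       (λ wx∈M → w≢v (disjointV' wx∈M vx∈M)) ((y , wy∈M) , (v , vx∈M))

  proj₁-injective-on-M : ∀ {e f} → e ∈ M → f ∈ M → proj₁ e ≡ proj₁ f → e ≡ f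
  proj₁-injective-on-M {u , _} {.u , _} e∈M f∈M refl = cong (u ,_) (disjointV e∈M f∈M)

  length≡∣S∣ : length M ≡ ∣ S ∣
  length≡∣S∣ = trans (sym (length-map proj₁ M))
    (length-listing≡∣p∣ S (Unique-map⁺-on proj₁-injective-on-M unique) ⊆S S⊆)
    where
    ⊆S : ∀ {u} → u ∈ map proj₁ M → u Subset.∈ S
    ⊆S {u} u∈ with ∈-map⁻ proj₁ u∈
    ... | (_ , x) , ux∈M , refl = proj₂ (M-covers u) (x , ux∈M)
    S⊆ : ∀ {u} → u Subset.∈ S → u ∈ map proj₁ M
    S⊆ {u} u∈S = ∈-map⁺ proj₁ (proj₂ (proj₁ (M-covers u) u∈S))

module FromIrredundant {n} (G : Graph n) {S : Subset n} (S-irr : Irredundant G S) where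

  -- Outside S the value is irrelevant.
  private-vertex : Fin n → Fin n
  private-vertex v with v ∈? S
  ... | yes v∈S = proj₁ (S-irr v v∈S)
  ... | no _    = v

  private-vertex-private : ∀ {v} → v Subset.∈ S →
    Dominates G v (private-vertex v)
    × (∀ w → w Subset.∈ S → w ≢ v → ¬ Dominates G w (private-vertex v))
  private-vertex-private {v} v∈S with v ∈? S
  ... | yes v∈S′ = proj₂ (S-irr v v∈S′)
  ... | no v∉S   = ⊥-elim (v∉S v∈S)

  matching : List (Fin n × Fin n)
  matching = map (λ v → v , private-vertex v) (elements S)

  ∈-matching⁻ : ∀ {u x} → (u , x) ∈ matching → u Subset.∈ S × x ≡ private-vertex u
  ∈-matching⁻ ux∈ with ∈-map⁻ (λ v → v , private-vertex v) ux∈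
  ... | v , v∈ , refl = ∈-elements⁻ S v∈ , refl

  ∈-matching⁺ : ∀ {u} → u Subset.∈ S → (u , private-vertex u) ∈ matching
  ∈-matching⁺ u∈S = ∈-map⁺ (λ v → v , private-vertex v) (∈-elements⁺ S u∈S)

  private-vertex-injective : ∀ {u w} → u Subset.∈ S → w Subset.∈ S →
    private-vertex u ≡ private-vertex w → u ≡ w
  private-vertex-injective {u} {w} u∈S w∈S pu≡pw with u ≟ w
  ... | yes u≡w = u≡w
  ... | no  u≢w = ⊥-elim (proj₂ (private-vertex-private u∈S) w w∈S (u≢w ∘ sym)
                    (subst (Dominates G w) (sym pu≡pw) (proj₁ (private-vertex-private w∈S))))

  independent : IndependentEdges G matching
  independent = record
    { unique     = Unique.map⁺ (cong proj₁) (elements-unique S)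
    ; subsetF    = All.tabulate in-F
    ; disjointV  = λ ux∈ uy∈ → trans (proj₂ (∈-matching⁻ ux∈)) (sym (proj₂ (∈-matching⁻ uy∈)))
    ; disjointV' = disjointV′
    ; indepW     = only-matching-edges
    }
    where
    in-F : ∀ {e} → e ∈ matching → HEdge G (proj₁ e) (proj₂ e)
    in-F {u , x} ux∈ with ∈-matching⁻ ux∈
    ... | u∈S , refl = Dominates⇒HEdge G (proj₁ (private-vertex-private u∈S))

    disjointV′ : ∀ {u w x} → (u , x) ∈ matching → (w , x) ∈ matching → u ≡ w
    disjointV′ ux∈ wx∈ with ∈-matching⁻ ux∈ | ∈-matching⁻ wx∈
    ... | u∈S , x≡pu | w∈S , x≡pw = private-vertex-injective u∈S w∈S (trans (sym x≡pu) x≡pw)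

    only-matching-edges : ∀ u x → HEdge G u x → ¬ (u , x) ∈ matching →
      ¬ (InW matching (inj₁ u) × InW matching (inj₂ x))
    only-matching-edges u x ux∈F ux∉ ((_ , uy∈) , (w , wx∈))
      with ∈-matching⁻ uy∈ | ∈-matching⁻ wx∈ | u ≟ w
    ... | u∈S , _ | _   , refl | yes refl = ux∉ (∈-matching⁺ u∈S)
    ... | u∈S , _ | w∈S , refl | no  u≢w  =
      proj₂ (private-vertex-private w∈S) u u∈S u≢w (HEdge⇒Dominates G ux∈F)

  covers : IsVPart matching S
  covers u = (λ u∈S → private-vertex u , ∈-matching⁺ u∈S)
           , (λ (_ , ux∈) → proj₁ (∈-matching⁻ ux∈))

  length≡∣S∣ : length matching ≡ ∣ S ∣
  length≡∣S∣ = trans (length-map _ (elements S)) (sym (∣p∣≡length-elements S))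

mainTheorem9 : ∀ {n : ℕ} (G : Graph n) →
    (∀ (M : List (Fin n × Fin n)) (S : Subset n) →
      IndependentEdges G M → IsVPart M S →
      Irredundant G S × length M ≡ ∣ S ∣)
    × (∀ (S : Subset n) → Irredundant G S →
      ∃[ M ] (IndependentEdges G M × IsVPart M S × length M ≡ ∣ S ∣))
mainTheorem9 G =
  (λ M S M-indep M-covers → let open FromIndependentEdges G M-indep M-covers
                             in irredundant , length≡∣S∣)
  , (λ S S-irr → let open FromIrredundant G S-irr
                  in matching , independent , covers , length≡∣S∣)
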